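{- Let $C$ be a set, $G$ a Plott function on $C$, and $\prec=\prec_G$. Then: (L0) $\prec$ is irreflexive; (L1) if $A'\subseteq A\prec B$ then $A'\prec B$; (L2) if $(A_i)_{i\in I}$ is a nonempty family of subsets of $C$ with $A_i\prec B$ for all $i$, then $\bigcup_i A_i\prec B$; (L3) if $A\prec B\subseteq B'$ then $A\prec B'$; (L4) if $A\prec A\cup B$ then $A\prec B$; (L5) if $A$ is essential and $B$ is insignificant, then $B\prec A$.
   Context: A choice function on a set $C$ is a map $G:2^C\to 2^C$ with $G(X)\subseteq X$ for all $X\subseteq C$; it is a Plott function if $G(X\cup Y)=G(G(X)\cup Y)$ for all $X,Y\subseteq C$. The Lehmann hyper-relation $\prec_G$ on subsets of $C$: $A\prec_G B$ iff $G(B)\neq\emptyset$ and $G(A\cup B)\cap A=\emptyset$. A set $B\subseteq C$ is essential (w.r.t. $\prec$) if $\emptyset\prec B$, and insignificant otherwise. -}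

module Defs where

open import Level using (0ℓ)
open import Data.Product using (_×_)
open import Relation.Nullary using (¬_)
open import Relation.Unary using (Pred; _⊆_; _∪_; _∩_; ∅; _≐_)

-- Subsets of a set C are predicates on C (extensional equality _≐_).
Subset : Set → Set₁
Subset C = Pred C 0ℓ

NonEmpty : {C : Set} → Subset C → Set
NonEmpty X = ¬ (X ≐ ∅)

-- A choice function G : 2^C → 2^C with G(X) ⊆ X.  Since subsets are
-- predicates, we also require that G is well defined on sets, i.e. it
-- respects extensional equality of subsets.
record IsChoiceFunction {C : Set} (G : Subset C → Subset C) : Set₁ where
  field
    contracting : ∀ X → G X ⊆ X
    respects-≐  : ∀ {X Y} → X ≐ Y → G X ≐ G Y

IsPlott : {C : Set} (G : Subset C → Subset C) → Set₁
IsPlott G = IsChoiceFunction G × (∀ X Y → G (X ∪ Y) ≐ G (G X ∪ Y))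

Lehmann : {C : Set} (G : Subset C → Subset C) → Subset C → Subset C → Set
Lehmann G A B = NonEmpty (G B) × ((G (A ∪ B) ∩ A) ≐ ∅)

Essential : {C : Set} → (Subset C → Subset C → Set) → Subset C → Set
Essential _≺_ B = ∅ ≺ B

Insignificant : {C : Set} → (Subset C → Subset C → Set) → Subset C → Set
Insignificant _≺_ B = ¬ (∅ ≺ B)

{-# OPTIONS --safe #-}
module Submission where

open import Defs
open import Level using (0ℓ)
open import Data.Product using (_×_; _,_; proj₁; proj₂)
open import Data.Sum using (inj₁; inj₂; [_,_]; map₁; map₂)
open import Data.Empty using (⊥-elim)
open import Function using (id; _∘_)
open import Relation.Nullary using (¬_)
open import Relation.Nullary.Decidable using (toSum)
open import Relation.Unary using (_⊆_; _∪_; ⋃; _∩_; ∅; _≐_)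
open import Relation.Unary.Properties using (≐-sym; ≐-trans)
open import Axiom.ExcludedMiddle using (ExcludedMiddle)

-- Path independence gives Aizerman's axiom (G Y ⊆ X ⊆ Y ⇒ G X = G Y)
-- constructively and, with excluded middle, Chernoff's heritage axiom
-- (X ⊆ Y ⇒ X ∩ G Y ⊆ G X).  Antitonicity on the left and (L4) follow from
-- Aizerman, since A ≺ B forces G (A ∪ B) ⊆ B; unions on the left,
-- monotonicity on the right and (L5) follow from heritage.

module PlottFunction {C : Set} {G : Subset C → Subset C} (plott : IsPlott G) where
  open IsChoiceFunction (proj₁ plott)

  path-independence : ∀ X Y → G (X ∪ Y) ≐ G (G X ∪ Y)
  path-independence = proj₂ plott

  aizerman : ∀ {X Y} → G Y ⊆ X → X ⊆ Y → G X ≐ G Y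
  aizerman {X} {Y} GY⊆X X⊆Y =
    ≐-sym (≐-trans (respects-≐ Y≐Y∪X)
          (≐-trans (path-independence Y X) (respects-≐ GY∪X≐X)))
    where
      Y≐Y∪X : Y ≐ Y ∪ X
      Y≐Y∪X = inj₁ , [ id , X⊆Y ]
      GY∪X≐X : G Y ∪ X ≐ X
      GY∪X≐X = [ GY⊆X , id ] , inj₂

  -- Split Y into X and Y ∖ X; path independence lets G act on X first.
  heritage : ExcludedMiddle 0ℓ → ∀ {X Y} → X ⊆ Y → X ∩ G Y ⊆ G X
  heritage em {X} {Y} X⊆Y (x∈X , x∈GY)
    with contracting (G X ∪ Y∖X) (proj₁ (path-independence X Y∖X)
                                   (proj₁ (respects-≐ Y≐X∪Y∖X) x∈GY))
    where
      Y∖X : Subset C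
      Y∖X y = Y y × ¬ X y
      Y≐X∪Y∖X : Y ≐ X ∪ Y∖X
      Y≐X∪Y∖X = (λ {y} y∈Y → map₂ (y∈Y ,_) (toSum (em {X y})))
              , [ X⊆Y , proj₁ ]
  ... | inj₁ x∈GX      = x∈GX
  ... | inj₂ (_ , x∉X) = ⊥-elim (x∉X x∈X)

  choice-⊆ʳ : ∀ {A B} → G (A ∪ B) ∩ A ≐ ∅ → G (A ∪ B) ⊆ B
  choice-⊆ʳ {A} {B} avoid x∈G = [ (λ x∈A → ⊥-elim (proj₁ avoid (x∈G , x∈A))) , id ]
                                  (contracting (A ∪ B) x∈G)

  nonEmpty-mono : ∀ {B B'} → B ⊆ B' → NonEmpty (G B) → NonEmpty (G B')
  nonEmpty-mono {B} B⊆B' GB≠∅ GB'≐∅ =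
    GB≠∅ (≐-trans (aizerman (λ x∈GB' → ⊥-elim (proj₁ GB'≐∅ x∈GB')) B⊆B') GB'≐∅)

  infix 4 _≺_
  _≺_ : Subset C → Subset C → Set
  _≺_ = Lehmann G

  nonEmpty⇒essential : ∀ {B} → NonEmpty (G B) → Essential _≺_ B
  nonEmpty⇒essential GB≠∅ = GB≠∅ , proj₂ , λ ()

  ≺-irrefl : ∀ A → ¬ (A ≺ A)
  ≺-irrefl A (GA≠∅ , avoid) =
    GA≠∅ ((λ x∈GA → proj₁ avoid (proj₁ (respects-≐ A≐A∪A) x∈GA , contracting A x∈GA))
         , λ ())
    where
      A≐A∪A : A ≐ A ∪ A
      A≐A∪A = inj₁ , [ id , id ]

  ≺-antitoneˡ : ∀ A' A B → A' ⊆ A → A ≺ B → A' ≺ B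
  ≺-antitoneˡ A' A B A'⊆A (GB≠∅ , avoid) =
    GB≠∅ , (λ (x∈G , x∈A') → proj₁ avoid (proj₁ G[A'∪B]≐G[A∪B] x∈G , A'⊆A x∈A')) , λ ()
    where
      G[A'∪B]≐G[A∪B] : G (A' ∪ B) ≐ G (A ∪ B)
      G[A'∪B]≐G[A∪B] = aizerman (inj₂ ∘ choice-⊆ʳ avoid) (map₁ A'⊆A)

  ≺-⋃ˡ : ExcludedMiddle 0ℓ → ∀ (I : Set) (A : I → Subset C) B → I →
         (∀ i → A i ≺ B) → ⋃ I A ≺ B
  ≺-⋃ˡ em I A B i₀ A≺B =
    proj₁ (A≺B i₀)
    , (λ (x∈G , (i , x∈Aᵢ)) →
         proj₁ (proj₂ (A≺B i)) (heritage em (map₁ (i ,_)) (inj₁ x∈Aᵢ , x∈G) , x∈Aᵢ))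
    , λ ()

  ≺-monotoneʳ : ExcludedMiddle 0ℓ → ∀ A B B' → A ≺ B → B ⊆ B' → A ≺ B'
  ≺-monotoneʳ em A B B' (GB≠∅ , avoid) B⊆B' =
    nonEmpty-mono B⊆B' GB≠∅
    , (λ (x∈G , x∈A) → proj₁ avoid (heritage em (map₂ B⊆B') (inj₁ x∈A , x∈G) , x∈A))
    , λ ()

  ≺-∪ʳ⁻ : ∀ A B → A ≺ (A ∪ B) → A ≺ B
  ≺-∪ʳ⁻ A B (G[A∪B]≠∅ , avoid) =
    (λ GB≐∅ → G[A∪B]≠∅ (≐-trans (≐-sym GB≐G[A∪B]) GB≐∅)) , avoid′
    where
      A∪B≐A∪A∪B : A ∪ B ≐ A ∪ (A ∪ B)
      A∪B≐A∪A∪B = map₂ inj₂ , [ inj₁ , id ]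
      avoid′ : G (A ∪ B) ∩ A ≐ ∅
      avoid′ = (λ (x∈G , x∈A) → proj₁ avoid (proj₁ (respects-≐ A∪B≐A∪A∪B) x∈G , x∈A))
             , λ ()
      GB≐G[A∪B] : G B ≐ G (A ∪ B)
      GB≐G[A∪B] = aizerman (choice-⊆ʳ avoid′) inj₂

  insignificant≺essential : ExcludedMiddle 0ℓ → ∀ A B →
                            Essential _≺_ A → Insignificant _≺_ B → B ≺ A
  insignificant≺essential em A B (GA≠∅ , _) B-insignificant =
    GA≠∅
    , (λ (x∈G , x∈B) → B-insignificant (nonEmpty⇒essential
        (λ GB≐∅ → proj₁ GB≐∅ (heritage em inj₁ (x∈B , x∈G)))))
    , λ ()

propositionA1 : ExcludedMiddle 0ℓ →
    (C : Set) (G : Subset C → Subset C) → IsPlott G →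
      -- (L0) irreflexivity
      (∀ A → ¬ Lehmann G A A)
      -- (L1) A' ⊆ A ≺ B ⇒ A' ≺ B
      × (∀ A' A B → A' ⊆ A → Lehmann G A B → Lehmann G A' B)
      -- (L2) nonempty family with A i ≺ B for all i ⇒ ⋃ A i ≺ B
      × (∀ (I : Set) (A : I → Subset C) B → I →
           (∀ i → Lehmann G (A i) B) → Lehmann G (⋃ I A) B)
      -- (L3) A ≺ B ⊆ B' ⇒ A ≺ B'
      × (∀ A B B' → Lehmann G A B → B ⊆ B' → Lehmann G A B')
      -- (L4) A ≺ A ∪ B ⇒ A ≺ B
      × (∀ A B → Lehmann G A (A ∪ B) → Lehmann G A B)
      -- (L5) A essential, B insignificant ⇒ B ≺ A
      × (∀ A B → Essential (Lehmann G) A → Insignificant (Lehmann G) B →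
           Lehmann G B A)
propositionA1 em C G plott =
  ≺-irrefl , ≺-antitoneˡ , ≺-⋃ˡ em , ≺-monotoneʳ em , ≺-∪ʳ⁻ , insignificant≺essential em
  where open PlottFunction plott
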